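{- Let $m\geq 3$ be odd, $q=2^i$ with $\gcd(i,m)=1$, and $a\in\mathbb{F}_{2^m}^*$. Let $L_a(S)=S^{q^3}+aS^q+S\in\mathbb{F}_{2^m}[S]$ and $Q_a(T)=T^{q^2+q+1}+aT+1$. Then: (1) if $L_a$ has a nonzero root in $\mathbb{F}_{2^m}$, then $Q_a$ has a root in $\mathbb{F}_{2^m}^*$; (2) if $\gcd(i,m)=1$ (equivalently $\gcd(q-1,2^m-1)=1$), the converse also holds, so that $Q_a$ has a root in $\mathbb{F}_{2^m}^*$ if and only if $L_a$ has a nonzero root in $\mathbb{F}_{2^m}$.
   Context: $\mathbb{F}_{2^m}$ is the finite field with $2^m$ elements. -}

module Defs where

open import Level using (0ℓ)
open import Data.Nat using (ℕ; zero; suc)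
import Data.Nat as ℕ
open import Data.Fin using (Fin)
open import Data.Product using (∃; _×_)
open import Relation.Nullary using (¬_)
open import Relation.Binary.PropositionalEquality using (_≡_)
open import Algebra.Bundles using (CommutativeRing)

-- A finite field with exactly 2^m elements (any such field is F_{2^m},
-- unique up to isomorphism).
record FiniteField2^ (m : ℕ) : Set₁ where
  field
    cring : CommutativeRing 0ℓ 0ℓ
  open CommutativeRing cring public
  field
    1≉0      : ¬ (1# ≈ 0#)
    inverse  : ∀ x → ¬ (x ≈ 0#) → ∃ λ y → (x * y) ≈ 1#
    char2    : (1# + 1#) ≈ 0#
    enum     : Fin (2 ℕ.^ m) → Carrier
    enum-inj : ∀ k l → enum k ≈ enum l → k ≡ l
    enum-sur : ∀ x → ∃ λ k → enum k ≈ x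

  infixr 8 _^_
  _^_ : Carrier → ℕ → Carrier
  x ^ zero  = 1#
  x ^ suc n = x * (x ^ n)

module _ {m : ℕ} (F : FiniteField2^ m) where
  open FiniteField2^ F

  L : ℕ → Carrier → Carrier → Carrier
  L q a S = (S ^ (q ℕ.^ 3)) + ((a * (S ^ q)) + S)

  Q : ℕ → Carrier → Carrier → Carrier
  Q q a T = (T ^ (q ℕ.* q ℕ.+ q ℕ.+ 1)) + ((a * T) + 1#)

-- For q = 2^i one has L_a(S) = S · Q_a(S^{q-1}), so a nonzero root S of L_a gives the
-- nonzero root S^{q-1} of Q_a.  Conversely, when gcd(i, m) = 1 the map x ↦ x^{q-1} is a
-- bijection of F_{2^m}: if z^{q-1} = 1 then z is fixed by both x ↦ x^{2^i} and (Fermat)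
-- x ↦ x^{2^m}, hence by x ↦ x^{2^gcd(i,m)} = x^2, so z = 1.  Every nonzero root T of Q_a is
-- therefore some S^{q-1}, and then L_a(S) = 0.
module Submission where

open import Defs
open import Data.Nat using (ℕ; _≤_; _^_; _%_)
open import Data.Nat.GCD using (gcd)
open import Data.Product using (∃; _×_)
open import Relation.Nullary using (¬_)
open import Relation.Binary.PropositionalEquality using (_≡_)

open import Level using (Level)
import Data.Nat as ℕ
import Data.Nat.Properties as ℕ
import Data.Nat.GCD as GCD
open import Data.Nat.Tactic.RingSolver using (solve-∀)
open import Data.Fin using (Fin; zero; suc; punchIn; punchOut)
open import Data.Fin.Properties
  using (any?; injective⇒≤; punchOut-injective; punchIn-injective; punchInᵢ≢i; punchIn-punchOut)
  renaming (_≟_ to _≟ᶠ_)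
open import Data.Fin.Permutation using (Permutation; permutation; _⟨$⟩ʳ_)
open import Data.Product using (_,_; proj₁; proj₂)
open import Data.Empty using (⊥-elim)
open import Function using (_∘_)
open import Function.Definitions using (Injective)
open import Algebra.Bundles using (Semiring)
open import Relation.Nullary using (yes; no; contradiction)
open import Relation.Binary.Definitions using (Decidable)
open import Relation.Binary.PropositionalEquality as ≡ using (_≢_)

injective⇒surjective : ∀ {n} (f : Fin n → Fin n) → Injective _≡_ _≡_ f → ∀ y → ∃ λ x → f x ≡ y
injective⇒surjective {ℕ.zero}  f f-inj ()
injective⇒surjective {ℕ.suc n} f f-inj y with any? (λ x → f x ≟ᶠ y)
... | yes hit = hit
... | no miss = contradiction (injective⇒≤ f′-inj) ℕ.1+n≰n
  where
  y≢f : ∀ x → y ≢ f x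
  y≢f x y≡fx = miss (x , ≡.sym y≡fx)

  f′ : Fin (ℕ.suc n) → Fin n
  f′ x = punchOut (y≢f x)

  f′-inj : Injective _≡_ _≡_ f′
  f′-inj {x} {x′} = f-inj ∘ punchOut-injective (y≢f x) (y≢f x′)

1+p*[q²+q+1]≡q³ : ∀ p → 1 ℕ.+ p ℕ.* ((1 ℕ.+ p) ℕ.* (1 ℕ.+ p) ℕ.+ (1 ℕ.+ p) ℕ.+ 1) ≡ (1 ℕ.+ p) ^ 3
1+p*[q²+q+1]≡q³ = expanded
  -- the ring solver does not see through _^_, so the cube is written out
  where
  expanded : ∀ p → 1 ℕ.+ p ℕ.* ((1 ℕ.+ p) ℕ.* (1 ℕ.+ p) ℕ.+ (1 ℕ.+ p) ℕ.+ 1)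
                   ≡ (1 ℕ.+ p) ℕ.* ((1 ℕ.+ p) ℕ.* ((1 ℕ.+ p) ℕ.* 1))
  expanded = solve-∀

2^-suc-pred : ∀ i → ℕ.suc (2 ^ i ℕ.∸ 1) ≡ 2 ^ i
2^-suc-pred i = ℕ.suc-pred (2 ^ i) {{ℕ.m^n≢0 2 i}}

gcd≡1⇒1≤ : ∀ {i m} → 2 ≤ m → gcd i m ≡ 1 → 1 ≤ i
gcd≡1⇒1≤ {ℕ.zero}  {m} 2≤m gcd≡1 = contradiction (≡.trans (≡.sym (GCD.gcd-identityˡ m)) gcd≡1) (ℕ.>⇒≢ 2≤m)
gcd≡1⇒1≤ {ℕ.suc _} _   _     = ℕ.s≤s ℕ.z≤n

module FrobeniusFixedPoints {a ℓ : Level} (R : Semiring a ℓ) (z : Semiring.Carrier R) where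
  open Semiring R
  open import Algebra.Properties.Semiring.Exp R renaming (_^_ to _↑_)
  open import Relation.Binary.Reasoning.Setoid setoid

  Fixed : ℕ → Set ℓ
  Fixed k = z ↑ (2 ^ k) ≈ z

  ↑-2^-+ : ∀ x c d → x ↑ (2 ^ (c ℕ.+ d)) ≈ (x ↑ (2 ^ c)) ↑ (2 ^ d)
  ↑-2^-+ x c d = begin
    x ↑ (2 ^ (c ℕ.+ d))        ≡⟨ ≡.cong (x ↑_) (ℕ.^-distribˡ-+-* 2 c d) ⟩
    x ↑ (2 ^ c ℕ.* 2 ^ d)      ≈⟨ ^-assocʳ x (2 ^ c) (2 ^ d) ⟨
    (x ↑ (2 ^ c)) ↑ (2 ^ d)    ∎

  fixed-multiple : ∀ {k} → Fixed k → ∀ c → Fixed (c ℕ.* k)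
  fixed-multiple fixed ℕ.zero    = *-identityʳ z
  fixed-multiple {k} fixed (ℕ.suc c) = begin
    z ↑ (2 ^ (k ℕ.+ c ℕ.* k))        ≈⟨ ↑-2^-+ z k (c ℕ.* k) ⟩
    (z ↑ (2 ^ k)) ↑ (2 ^ (c ℕ.* k))  ≈⟨ ^-congˡ (2 ^ (c ℕ.* k)) fixed ⟩
    z ↑ (2 ^ (c ℕ.* k))              ≈⟨ fixed-multiple fixed c ⟩
    z                                ∎

  -- w = z^(2^d) is fixed by x ↦ x^(2^c) because z is; but w^(2^c) = z^(2^(d+c)) = z.
  fixed-difference : ∀ d c → Fixed (d ℕ.+ c) → Fixed c → Fixed d
  fixed-difference d c fixed-d+c fixed-c = begin
    z ↑ (2 ^ d)                  ≈⟨ ^-congˡ (2 ^ d) fixed-c ⟨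
    (z ↑ (2 ^ c)) ↑ (2 ^ d)      ≈⟨ ↑-2^-+ z c d ⟨
    z ↑ (2 ^ (c ℕ.+ d))          ≡⟨ ≡.cong (λ k → z ↑ (2 ^ k)) (ℕ.+-comm c d) ⟩
    z ↑ (2 ^ (d ℕ.+ c))          ≈⟨ fixed-d+c ⟩
    z                            ∎

  fixed-gcd : ∀ {i j} → Fixed i → Fixed j → Fixed (gcd i j)
  fixed-gcd {i} {j} fixed-i fixed-j with GCD.Bézout.identity (GCD.gcd-GCD i j)
  ... | GCD.Bézout.+- x y d+yj≡xi =
    fixed-difference (gcd i j) (y ℕ.* j)
      (≡.subst Fixed (≡.sym d+yj≡xi) (fixed-multiple fixed-i x)) (fixed-multiple fixed-j y)
  ... | GCD.Bézout.-+ x y d+xi≡yj =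
    fixed-difference (gcd i j) (x ℕ.* i)
      (≡.subst Fixed (≡.sym d+xi≡yj) (fixed-multiple fixed-j y)) (fixed-multiple fixed-i x)

module FiniteFieldProperties {m : ℕ} (F : FiniteField2^ m) where
  open FiniteField2^ F hiding (zero; _^_)
  -- _^ᶠ_ is the power in which L and Q are written; the library's _↑_ comes with its laws.
  open FiniteField2^ F using () renaming (_^_ to _^ᶠ_)
  open import Algebra.Properties.CommutativeSemiring.Exp commutativeSemiring renaming (_^_ to _↑_)
  open import Algebra.Properties.CommutativeMonoid.Sum *-commutativeMonoid
    using () renaming (sum to product; sum-permute to product-permute;
      sum-cong-≋ to product-cong; ∑-distrib-+ to ∏-distrib-*; sum-replicate to product-replicate)
  open import Relation.Binary.Reasoning.Setoid setoid

  inverse-cancelˡ : ∀ {x x′} → x * x′ ≈ 1# → ∀ y → x′ * (x * y) ≈ y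
  inverse-cancelˡ {x} {x′} xx′≈1 y = begin
    x′ * (x * y)   ≈⟨ *-assoc x′ x y ⟨
    (x′ * x) * y   ≈⟨ *-congʳ (trans (*-comm x′ x) xx′≈1) ⟩
    1# * y         ≈⟨ *-identityˡ y ⟩
    y              ∎

  *-cancelˡ : ∀ {x y w} → x ≉ 0# → x * y ≈ x * w → y ≈ w
  *-cancelˡ {x} {y} {w} x≉0 xy≈xw with inverse x x≉0
  ... | x′ , xx′≈1 = begin
    y              ≈⟨ inverse-cancelˡ xx′≈1 y ⟨
    x′ * (x * y)   ≈⟨ *-congˡ xy≈xw ⟩
    x′ * (x * w)   ≈⟨ inverse-cancelˡ xx′≈1 w ⟩
    w              ∎

  *-nonzero : ∀ {x y} → x ≉ 0# → y ≉ 0# → x * y ≉ 0#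
  *-nonzero {x} x≉0 y≉0 xy≈0 = y≉0 (*-cancelˡ x≉0 (trans xy≈0 (sym (zeroʳ x))))

  inverse-nonzero : ∀ {x x′} → x * x′ ≈ 1# → x′ ≉ 0#
  inverse-nonzero {x} xx′≈1 x′≈0 = 1≉0 (trans (sym xx′≈1) (trans (*-congˡ x′≈0) (zeroʳ x)))

  ↑-nonzero : ∀ {x} n → x ≉ 0# → x ↑ n ≉ 0#
  ↑-nonzero ℕ.zero    x≉0 = 1≉0
  ↑-nonzero (ℕ.suc n) x≉0 = *-nonzero x≉0 (↑-nonzero n x≉0)

  ↑-zero : ∀ {x n} → 1 ≤ n → x ≈ 0# → x ↑ n ≈ 0#
  ↑-zero {x} {ℕ.suc n} _ x≈0 = trans (*-congʳ x≈0) (zeroˡ (x ↑ n))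

  product-nonzero : ∀ {n} (f : Fin n → Carrier) → (∀ j → f j ≉ 0#) → product f ≉ 0#
  product-nonzero {ℕ.zero}  f f≉0 = 1≉0
  product-nonzero {ℕ.suc n} f f≉0 = *-nonzero (f≉0 zero) (product-nonzero (f ∘ suc) (f≉0 ∘ suc))

  index : Carrier → Fin (2 ^ m)
  index x = proj₁ (enum-sur x)

  enum-index : ∀ x → enum (index x) ≈ x
  enum-index x = proj₂ (enum-sur x)

  index-injective : ∀ {x y} → index x ≡ index y → x ≈ y
  index-injective {x} {y} same = trans (sym (enum-index x)) (trans (reflexive (≡.cong enum same)) (enum-index y))

  index-cong : ∀ {x y} → x ≈ y → index x ≡ index y
  index-cong {x} {y} x≈y = enum-inj _ _ (trans (enum-index x) (trans x≈y (sym (enum-index y))))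

  _≟_ : Decidable _≈_
  x ≟ y with index x ≟ᶠ index y
  ... | yes same = yes (index-injective same)
  ... | no differ = no (differ ∘ index-cong)

  record UnitEnumeration (n : ℕ) : Set where
    field
      unit       : Fin n → Carrier
      unit≉0     : ∀ j → unit j ≉ 0#
      unit-inj   : ∀ {j k} → unit j ≈ unit k → j ≡ k
      unitIndex  : ∀ x → x ≉ 0# → Fin n
      unit-index : ∀ x (x≉0 : x ≉ 0#) → unit (unitIndex x x≉0) ≈ x

  unitEnumeration : ∀ {n} (e : Fin (ℕ.suc n) → Carrier) →
    (∀ k l → e k ≈ e l → k ≡ l) → (∀ x → ∃ λ k → e k ≈ x) → UnitEnumeration n
  unitEnumeration {n} e e-inj e-sur = record
    { unit       = unit
    ; unit≉0     = λ j → punchInᵢ≢i k₀ j ∘ e-inj _ _ ∘ λ ej≈0 → trans ej≈0 (sym ek₀≈0)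
    ; unit-inj   = punchIn-injective k₀ _ _ ∘ e-inj _ _
    ; unitIndex  = λ x x≉0 → punchOut (k₀≢ x x≉0)
    ; unit-index = λ x x≉0 → trans (reflexive (≡.cong e (punchIn-punchOut (k₀≢ x x≉0))))
                                   (proj₂ (e-sur x))
    }
    where
    k₀ : Fin (ℕ.suc n)
    k₀ = proj₁ (e-sur 0#)

    ek₀≈0 : e k₀ ≈ 0#
    ek₀≈0 = proj₂ (e-sur 0#)

    unit : Fin n → Carrier
    unit = e ∘ punchIn k₀

    k₀≢ : ∀ x → x ≉ 0# → k₀ ≢ proj₁ (e-sur x)
    k₀≢ x x≉0 k₀≡k = x≉0 (trans (sym (proj₂ (e-sur x))) (trans (reflexive (≡.cong e (≡.sym k₀≡k))) ek₀≈0))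

  module _ {n} (U : UnitEnumeration n) where
    open UnitEnumeration U

    scale : ∀ {w} → w ≉ 0# → Fin n → Fin n
    scale w≉0 j = unitIndex _ (*-nonzero w≉0 (unit≉0 j))

    unit-scale : ∀ {w} (w≉0 : w ≉ 0#) j → unit (scale w≉0 j) ≈ w * unit j
    unit-scale w≉0 j = unit-index _ (*-nonzero w≉0 (unit≉0 j))

    scale-inverse : ∀ {w w′} (w≉0 : w ≉ 0#) (w′≉0 : w′ ≉ 0#) → w′ * w ≈ 1# →
                    ∀ j → scale w≉0 (scale w′≉0 j) ≡ j
    scale-inverse {w} {w′} w≉0 w′≉0 w′w≈1 j = unit-inj (begin
      unit (scale w≉0 (scale w′≉0 j))   ≈⟨ unit-scale w≉0 _ ⟩
      w * unit (scale w′≉0 j)           ≈⟨ *-congˡ (unit-scale w′≉0 j) ⟩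
      w * (w′ * unit j)                 ≈⟨ inverse-cancelˡ w′w≈1 (unit j) ⟩
      unit j                            ∎)

    -- Multiplication by z permutes the units, so ∏ u = ∏ z u = z^n ∏ u.
    unit-↑-card : ∀ {z} → z ≉ 0# → z ↑ n ≈ 1#
    unit-↑-card {z} z≉0 with inverse z z≉0
    ... | z′ , zz′≈1 = sym (*-cancelˡ (product-nonzero unit unit≉0) (begin
      product unit * 1#                     ≈⟨ *-identityʳ _ ⟩
      product unit                          ≈⟨ product-permute unit π ⟩
      product (unit ∘ scale z≉0)            ≈⟨ product-cong (unit-scale z≉0) ⟩
      product (λ j → z * unit j)            ≈⟨ ∏-distrib-* {n} (λ _ → z) unit ⟩
      product {n} (λ _ → z) * product unit  ≈⟨ *-congʳ (product-replicate n {z}) ⟩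
      z ↑ n * product unit                  ≈⟨ *-comm _ _ ⟩
      product unit * z ↑ n                  ∎))
      where
      z′≉0 : z′ ≉ 0#
      z′≉0 = inverse-nonzero zz′≈1

      π : Permutation n n
      π = permutation (scale z≉0) (scale z′≉0)
            (scale-inverse z≉0 z′≉0 (trans (*-comm z′ z) zz′≈1)) (scale-inverse z′≉0 z≉0 zz′≈1)

  ↑-card : ∀ {N} (e : Fin N → Carrier) →
    (∀ k l → e k ≈ e l → k ≡ l) → (∀ x → ∃ λ k → e k ≈ x) → ∀ z → z ↑ N ≈ z
  ↑-card {ℕ.zero} e e-inj e-sur z with e-sur z
  ... | () , _
  ↑-card {ℕ.suc n} e e-inj e-sur z with z ≟ 0#
  ... | yes z≈0 = trans (↑-zero (ℕ.s≤s (ℕ.z≤n {n})) z≈0) (sym z≈0)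
  ... | no z≉0  = trans (*-congˡ (unit-↑-card (unitEnumeration e e-inj e-sur) z≉0)) (*-identityʳ z)

  fermat : ∀ z → z ↑ (2 ^ m) ≈ z
  fermat = ↑-card enum enum-inj enum-sur

  idempotent-nonzero≈1 : ∀ {z} → z ≉ 0# → z * z ≈ z → z ≈ 1#
  idempotent-nonzero≈1 {z} z≉0 zz≈z = *-cancelˡ z≉0 (trans zz≈z (sym (*-identityʳ z)))

  ↑[2^i∸1]≈1⇒≈1 : ∀ {i z} → gcd i m ≡ 1 → z ≉ 0# → z ↑ (2 ^ i ℕ.∸ 1) ≈ 1# → z ≈ 1#
  ↑[2^i∸1]≈1⇒≈1 {i} {z} gcd≡1 z≉0 z↑p≈1 = idempotent-nonzero≈1 z≉0 (begin
    z * z                 ≈⟨ *-congˡ (*-identityʳ z) ⟨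
    z ↑ 2                 ≈⟨ ≡.subst Fixed gcd≡1 (fixed-gcd {i} {m} fixed-i (fermat z)) ⟩
    z                     ∎)
    where
    open FrobeniusFixedPoints semiring z using (Fixed; fixed-gcd)

    fixed-i : Fixed i
    fixed-i = begin
      z ↑ (2 ^ i)                      ≡⟨ ≡.cong (z ↑_) (2^-suc-pred i) ⟨
      z * z ↑ (2 ^ i ℕ.∸ 1)            ≈⟨ *-congˡ z↑p≈1 ⟩
      z * 1#                           ≈⟨ *-identityʳ z ⟩
      z                                ∎

  ↑-injective : ∀ {n} → 1 ≤ n → (∀ {z} → z ≉ 0# → z ↑ n ≈ 1# → z ≈ 1#) →
                ∀ {x y} → x ↑ n ≈ y ↑ n → x ≈ y
  ↑-injective {n} 1≤n trivial-kernel {x} {y} xⁿ≈yⁿ with x ≟ 0# | y ≟ 0#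
  ... | yes x≈0 | yes y≈0 = trans x≈0 (sym y≈0)
  ... | yes x≈0 | no y≉0  = ⊥-elim (↑-nonzero n y≉0 (trans (sym xⁿ≈yⁿ) (↑-zero 1≤n x≈0)))
  ... | no x≉0  | yes y≈0 = ⊥-elim (↑-nonzero n x≉0 (trans xⁿ≈yⁿ (↑-zero 1≤n y≈0)))
  ... | no x≉0  | no y≉0 with inverse y y≉0
  ...   | y′ , yy′≈1 = begin
    x         ≈⟨ y*r≈x ⟨
    y * r     ≈⟨ *-congˡ r≈1 ⟩
    y * 1#    ≈⟨ *-identityʳ y ⟩
    y         ∎
    where
    r : Carrier
    r = y′ * x

    y*r≈x : y * r ≈ x
    y*r≈x = inverse-cancelˡ (trans (*-comm y′ y) yy′≈1) x

    r≈1 : r ≈ 1#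
    r≈1 = trivial-kernel (*-nonzero (inverse-nonzero yy′≈1) x≉0) (*-cancelˡ (↑-nonzero n y≉0) (begin
      y ↑ n * r ↑ n   ≈⟨ ^-distrib-* y r n ⟨
      (y * r) ↑ n     ≈⟨ ^-congˡ n y*r≈x ⟩
      x ↑ n           ≈⟨ xⁿ≈yⁿ ⟩
      y ↑ n           ≈⟨ *-identityʳ _ ⟨
      y ↑ n * 1#      ∎))

  ≈-injective⇒surjective : (f : Carrier → Carrier) → (∀ {x y} → f x ≈ f y → x ≈ y) →
                           ∀ y → ∃ λ x → f x ≈ y
  ≈-injective⇒surjective f f-inj y with injective⇒surjective f̂ f̂-inj (index y)
    where
    f̂ : Fin (2 ^ m) → Fin (2 ^ m)
    f̂ = index ∘ f ∘ enum

    f̂-inj : Injective _≡_ _≡_ f̂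
    f̂-inj {k} {l} = enum-inj k l ∘ f-inj ∘ index-injective
  ... | k , f̂k≡iy = enum k , index-injective f̂k≡iy

  ^ᶠ≡↑ : ∀ x n → x ^ᶠ n ≡ x ↑ n
  ^ᶠ≡↑ x ℕ.zero    = ≡.refl
  ^ᶠ≡↑ x (ℕ.suc n) = ≡.cong (x *_) (^ᶠ≡↑ x n)

  Q-cong : ∀ q a {T T′} → T ≈ T′ → Q F q a T ≈ Q F q a T′
  Q-cong q a {T} {T′} T≈T′ = +-cong leading (+-congʳ (*-congˡ T≈T′))
    where
    E : ℕ
    E = q ℕ.* q ℕ.+ q ℕ.+ 1

    leading : T ^ᶠ E ≈ T′ ^ᶠ E
    leading = begin
      T ^ᶠ E    ≡⟨ ^ᶠ≡↑ T E ⟩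
      T ↑ E     ≈⟨ ^-congˡ E T≈T′ ⟩
      T′ ↑ E    ≡⟨ ^ᶠ≡↑ T′ E ⟨
      T′ ^ᶠ E   ∎

  L≈S*Q[Sᵖ] : ∀ {q p} → q ≡ ℕ.suc p → ∀ a S → L F q a S ≈ S * Q F q a (S ↑ p)
  L≈S*Q[Sᵖ] {q} {p} ≡.refl a S = sym (begin
    S * (T ^ᶠ E + (a * T + 1#))             ≈⟨ distribˡ S _ _ ⟩
    S * T ^ᶠ E + S * (a * T + 1#)           ≈⟨ +-congˡ (distribˡ S _ _) ⟩
    S * T ^ᶠ E + (S * (a * T) + S * 1#)     ≈⟨ +-cong leading (+-cong linear (*-identityʳ S)) ⟩
    S ^ᶠ (q ^ 3) + (a * S ^ᶠ q + S)         ∎)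
    where
    T : Carrier
    T = S ↑ p

    E : ℕ
    E = q ℕ.* q ℕ.+ q ℕ.+ 1

    leading : S * T ^ᶠ E ≈ S ^ᶠ (q ^ 3)
    leading = begin
      S * T ^ᶠ E             ≡⟨ ≡.cong (S *_) (^ᶠ≡↑ T E) ⟩
      S * T ↑ E              ≈⟨ *-congˡ (^-assocʳ S p E) ⟩
      S ↑ ℕ.suc (p ℕ.* E)    ≡⟨ ≡.cong (S ↑_) (1+p*[q²+q+1]≡q³ p) ⟩
      S ↑ (q ^ 3)            ≡⟨ ^ᶠ≡↑ S (q ^ 3) ⟨
      S ^ᶠ (q ^ 3)           ∎

    linear : S * (a * T) ≈ a * S ^ᶠ q
    linear = begin
      S * (a * T)     ≈⟨ *-assoc S a T ⟨
      (S * a) * T     ≈⟨ *-congʳ (*-comm S a) ⟩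
      (a * S) * T     ≈⟨ *-assoc a S T ⟩
      a * S ↑ q       ≡⟨ ≡.cong (a *_) (^ᶠ≡↑ S q) ⟨
      a * S ^ᶠ q      ∎

  HasNonzeroRoot : (Carrier → Carrier) → Set
  HasNonzeroRoot f = ∃ λ x → x ≉ 0# × f x ≈ 0#

  L-root⇒Q-root : ∀ {q p} → q ≡ ℕ.suc p → ∀ a → HasNonzeroRoot (L F q a) → HasNonzeroRoot (Q F q a)
  L-root⇒Q-root {p = p} q≡1+p a (S , S≉0 , L≈0) = S ↑ p , ↑-nonzero p S≉0 ,
    *-cancelˡ S≉0 (trans (sym (L≈S*Q[Sᵖ] q≡1+p a S)) (trans L≈0 (sym (zeroʳ S))))

  Q-root⇒L-root : ∀ {q p} → q ≡ ℕ.suc p → 1 ≤ p → (∀ {x y} → x ↑ p ≈ y ↑ p → x ≈ y) →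
                  ∀ a → HasNonzeroRoot (Q F q a) → HasNonzeroRoot (L F q a)
  Q-root⇒L-root {q} {p} q≡1+p 1≤p ↑p-inj a (T , T≉0 , Q≈0) with ≈-injective⇒surjective (_↑ p) ↑p-inj T
  ... | S , Sᵖ≈T = S , (λ S≈0 → T≉0 (trans (sym Sᵖ≈T) (↑-zero {n = p} 1≤p S≈0))) ,
    trans (L≈S*Q[Sᵖ] q≡1+p a S) (trans (*-congˡ (trans (Q-cong q a Sᵖ≈T) Q≈0)) (zeroʳ S))

proposition2p8 : (m : ℕ) → 3 ≤ m → m % 2 ≡ 1 → (i : ℕ) → gcd i m ≡ 1 →
    (F : FiniteField2^ m) → (a : FiniteField2^.Carrier F) →
    ¬ (FiniteField2^._≈_ F a (FiniteField2^.0# F)) →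
    ((∃ λ S → ¬ (FiniteField2^._≈_ F S (FiniteField2^.0# F)) × FiniteField2^._≈_ F (L F (2 ^ i) a S) (FiniteField2^.0# F))
      → (∃ λ T → ¬ (FiniteField2^._≈_ F T (FiniteField2^.0# F)) × FiniteField2^._≈_ F (Q F (2 ^ i) a T) (FiniteField2^.0# F)))
    × ((∃ λ T → ¬ (FiniteField2^._≈_ F T (FiniteField2^.0# F)) × FiniteField2^._≈_ F (Q F (2 ^ i) a T) (FiniteField2^.0# F))
      → (∃ λ S → ¬ (FiniteField2^._≈_ F S (FiniteField2^.0# F)) × FiniteField2^._≈_ F (L F (2 ^ i) a S) (FiniteField2^.0# F)))
proposition2p8 m 3≤m _ i gcd≡1 F a _ =
  L-root⇒Q-root q≡1+p a , Q-root⇒L-root q≡1+p 1≤p (↑-injective {p} 1≤p (↑[2^i∸1]≈1⇒≈1 {i} gcd≡1)) a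
  where
  open FiniteFieldProperties F

  p : ℕ
  p = 2 ^ i ℕ.∸ 1

  q≡1+p : 2 ^ i ≡ ℕ.suc p
  q≡1+p = ≡.sym (2^-suc-pred i)

  1≤p : 1 ≤ p
  1≤p = ℕ.∸-monoˡ-≤ 1 (ℕ.^-monoʳ-≤ 2 {1} {i} (gcd≡1⇒1≤ (ℕ.≤-trans (ℕ.n≤1+n 2) 3≤m) gcd≡1))
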